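{- Let $m,n\ge1$, let $D$ be a Dyck path of height $mn$, and let $i$ be such that $D\uparrow^G_i$ is defined (so $D\lessdot_G D\uparrow^G_i$). Let $x_i^D$ be the point of $D$ immediately before $r_i^D$. Then for every $j\in[mn]$, $$d^t_{D\uparrow^G_i}(j)=\begin{cases} d^t_D(j) & \text{if } t_j^D\neq r_i^D,\\ d^t_D(j)+\ell_D(r_i^D,h_i^D) & \text{if } t_j^D=r_i^D,\end{cases}\qquad d^h_{D\uparrow^G_i}(j)=\begin{cases} d^h_D(j) & \text{if } h_j^D\neq x_i^D,\\ d^h_D(j)+\ell_D(r_i^D,h_i^D) & \text{if } h_j^D=x_i^D.\end{cases}$$
   Context: Let $N_0=mn$ and $\nu=(NE)^{N_0}$. A Dyck path of height $N_0$ is a lattice path from $(0,0)$ to $(N_0,N_0)$ with unit north ($N$) and east ($E$) steps lying weakly above $\nu$. For such $D$ and $i\in[N_0]$, $r_i^D$ is the point immediately before its $i$-th north step. For $p=(x,y)$ on $D$, $\mathrm{horiz}(p)=X(y)-x$ with $X(y)$ the largest $x$-coordinate of a point of $\nu$ at height $y$. The touch point $t_i^D$ is the first point of $D$ after $r_i^D$ with the same horizontal distance as $r_i^D$; the hit point $h_i^D$ is the first point of $D$ after $r_i^D$ with that horizontal distance which is either followed by an east step or is the final point. For points $p,q$ on $D$, $\ell_D(p,q)$ is the number of steps of the subpath of $D$ from $p$ to $q$ divided by $2$. The touch distance vector is $d^t_D=(\ell_D(r_1^D,t_1^D),\dots,\ell_D(r_{N_0}^D,t_{N_0}^D))$ and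 the hit distance vector is $d^h_D=(\ell_D(r_1^D,h_1^D),\dots,\ell_D(r_{N_0}^D,h_{N_0}^D))$; $d^t_D(j)$, $d^h_D(j)$ denote their $j$-th components. If $r_i^D$ is preceded by an east step and followed by a north step, write $D=dEhf$ ($dE$ = subpath from $(0,0)$ to $r_i^D$, $h$ = subpath from $r_i^D$ to $h_i^D$, $f$ = the rest) and set $D\uparrow^G_i=dhEf$; the Greedy order has cover relations $D\lessdot_G D\uparrow^G_i$. -}

module Defs where

open import Data.Nat using (ℕ; zero; suc; _+_; _*_; _∸_; _≤_; _<_)
open import Data.Nat.DivMod using (_/_)
open import Data.Bool using (Bool; true; false; _∧_; _∨_)
open import Data.List using (List; []; _∷_; length; take; drop; _++_; replicate; concat)
open import Data.Product using (_×_; _,_)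
open import Data.Integer using (ℤ; +_; _-_)
import Data.Integer as ℤ
import Data.Nat as ℕ
open import Relation.Nullary.Decidable using (⌊_⌋)
open import Relation.Binary.PropositionalEquality using (_≡_)

data Step : Set where
  N E : Step

Path : Set
Path = List Step

nu : ℕ → Path
nu N₀ = concat (replicate N₀ (N ∷ E ∷ []))

nN : ℕ → Path → ℕ
nN zero    _       = 0
nN (suc k) []      = 0
nN (suc k) (N ∷ s) = suc (nN k s)
nN (suc k) (E ∷ s) = nN k s

nE : ℕ → Path → ℕ
nE zero    _       = 0
nE (suc k) []      = 0
nE (suc k) (N ∷ s) = nE k s
nE (suc k) (E ∷ s) = suc (nE k s)

point : Path → ℕ → ℕ × ℕ
point D k = nE k D , nN k D

-- X(y): the largest x-coordinate of a point of ν = (NE)^{N₀} at height y.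
-- The points of ν at height y (0 ≤ y ≤ N₀) are (y-1,y) (if y ≥ 1) and (y,y),
-- so X(y) = y.
nuX : ℕ → ℕ
nuX y = y

horiz : Path → ℕ → ℤ
horiz D k = + nuX (nN k D) - + nE k D

record IsDyck (N₀ : ℕ) (D : Path) : Set where
  field
    northCount : nN (length D) D ≡ N₀
    eastCount  : nE (length D) D ≡ N₀
    aboveNu    : ∀ k → k ≤ length D → nE k D ≤ nuX (nN k D)

isNAt : Path → ℕ → Bool
isNAt []      _       = false
isNAt (N ∷ s) zero    = true
isNAt (E ∷ s) zero    = false
isNAt (_ ∷ s) (suc k) = isNAt s k

isEAt : Path → ℕ → Bool
isEAt []      _       = false
isEAt (E ∷ s) zero    = true
isEAt (N ∷ s) zero    = false
isEAt (_ ∷ s) (suc k) = isEAt s k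

-- index (0-based) of the (c+1)-th north step of a path
-- (= index of the point immediately before that step).
nthN : Path → ℕ → ℕ
nthN []      _       = 0
nthN (N ∷ s) zero    = 0
nthN (N ∷ s) (suc c) = suc (nthN s c)
nthN (E ∷ s) c       = suc (nthN s c)

-- r_i^D, for i ∈ [N₀] given 0-based as i' = i - 1: position index of r_i^D.
rPos : Path → ℕ → ℕ
rPos D i' = nthN D i'

-- first q ∈ {a, a+1, …, a+fuel-1} with P q; returns a+fuel if none.
firstFrom : (ℕ → Bool) → ℕ → ℕ → ℕ
firstFrom P a zero       = a
firstFrom P a (suc fuel) with P a
... | true  = a
... | false = firstFrom P (suc a) fuel

sameHoriz : Path → ℕ → ℕ → Bool
sameHoriz D p q = ⌊ horiz D q ℤ.≟ horiz D p ⌋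

tPos : Path → ℕ → ℕ
tPos D i' = firstFrom (sameHoriz D p) (suc p) (length D ∸ p)
  where p = rPos D i'

hPos : Path → ℕ → ℕ
hPos D i' = firstFrom (λ q → sameHoriz D p q ∧ (⌊ q ℕ.≟ length D ⌋ ∨ isEAt D q)) (suc p) (length D ∸ p)
  where p = rPos D i'

ell : ℕ → ℕ → ℕ
ell p q = (q ∸ p) / 2

dt : Path → ℕ → ℕ
dt D i' = ell (rPos D i') (tPos D i')

dh : Path → ℕ → ℕ
dh D i' = ell (rPos D i') (hPos D i')

GreedyDefined : Path → ℕ → Set
GreedyDefined D i' = (1 ≤ rPos D i') × (isEAt D (rPos D i' ∸ 1) ≡ true) × (isNAt D (rPos D i') ≡ true)

-- D = d E h f  ↦  D ↑^G_i = d h E f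
greedyUp : Path → ℕ → Path
greedyUp D i' = take (p ∸ 1) D ++ (drop p (take q D) ++ (E ∷ drop q D))
  where
  p = rPos D i'
  q = hPos D i'

-- Write D = d E h f, where the displayed E step ends at r_i and h runs from r_i to the hit
-- point h_i, so that D ↑ = d h E f.  The two paths share their points outside h, while every
-- point of h moves one index back and one step west, which raises its horizontal distance by
-- one.  As h starts and ends at the level G of r_i and never drops below G, the raised copy
-- stays strictly above G and is now followed by the moved E step.  Hence a touch or hit
-- search started inside h is just shifted by one index, one started after h is unaffected,
-- and so is one started before h unless it used to stop at r_i (touch) or at x_i (hit): then
-- it has to cross the raised copy of h and stops at h_i, resp. at the moved E step, so the
-- distance grows by ℓ(r_i, h_i).

module Submission where

open import Defs
open import Data.Bool using (Bool; true; false; _∧_; _∨_)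
open import Data.Bool.Properties using (∧-conicalˡ; ∧-conicalʳ; ∨-conicalʳ; ∧-zeroʳ; ∨-zeroʳ)
open import Data.Empty using (⊥-elim)
import Data.Integer as ℤ
import Data.Integer.Properties as ℤᵖ
open import Data.List using ([]; _∷_; length; take; drop; _++_)
open import Data.List.Properties using (length-++; length-take; length-drop; take++drop≡id)
open import Data.Nat
open import Data.Nat.DivMod using (m*n/n≡m; +-distrib-/-∣ʳ)
open import Data.Nat.Divisibility using (m∣m*n)
open import Data.Nat.Properties
open import Data.Product using (_×_; _,_; proj₁; proj₂; ∃; map₁; map₂)
open import Data.Sum using (_⊎_; inj₁; inj₂)
open import Data.Fin using (Fin; toℕ)
open import Data.Fin.Properties using (toℕ<n)
open import Function using (_∘_)
open import Relation.Nullary using (Dec; yes; no; ¬_; contradiction)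
open import Relation.Nullary.Decidable using (⌊_⌋; isYes≗does; dec-true; dec-false)
open import Relation.Binary.PropositionalEquality
open import Relation.Binary.Definitions using (tri<; tri≈; tri>)

isYes-true : ∀ {a} {A : Set a} (a? : Dec A) → A → ⌊ a? ⌋ ≡ true
isYes-true a? a = trans (isYes≗does a?) (dec-true a? a)

isYes-false : ∀ {a} {A : Set a} (a? : Dec A) → ¬ A → ⌊ a? ⌋ ≡ false
isYes-false a? ¬a = trans (isYes≗does a?) (dec-false a? ¬a)

isYes-sound : ∀ {a} {A : Set a} (a? : Dec A) → ⌊ a? ⌋ ≡ true → A
isYes-sound (yes a) _ = a

∨-true : ∀ a b → a ∨ b ≡ true → a ≡ true ⊎ b ≡ true
∨-true true  _ _ = inj₁ refl
∨-true false _ e = inj₂ e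

true≢false : true ≢ false
true≢false ()

module _ (P : ℕ → Bool) where

  firstFrom-≥ : ∀ a fuel → a ≤ firstFrom P a fuel
  firstFrom-≥ a zero = ≤-refl
  firstFrom-≥ a (suc fuel) with P a
  ... | true  = ≤-refl
  ... | false = <⇒≤ (firstFrom-≥ (suc a) fuel)

  firstFrom-minimal : ∀ a fuel k → a ≤ k → k < firstFrom P a fuel → P k ≡ false
  firstFrom-minimal a zero k a≤k k<a = contradiction a≤k (<⇒≱ k<a)
  firstFrom-minimal a (suc fuel) k a≤k k<v with P a in Pa | m≤n⇒m<n∨m≡n a≤k
  ... | true  | _          = contradiction a≤k (<⇒≱ k<v)
  ... | false | inj₁ a<k   = firstFrom-minimal (suc a) fuel k a<k k<v
  ... | false | inj₂ refl  = Pa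

  firstFrom-found : ∀ a fuel → P (firstFrom P a fuel) ≡ true ⊎ firstFrom P a fuel ≡ a + fuel
  firstFrom-found a zero = inj₂ (sym (+-identityʳ a))
  firstFrom-found a (suc fuel) with P a in Pa
  ... | true  = inj₁ Pa
  ... | false with firstFrom-found (suc a) fuel
  ...   | inj₁ found = inj₁ found
  ...   | inj₂ end   = inj₂ (trans end (sym (+-suc a fuel)))

  firstFrom-unique : ∀ a fuel v → a ≤ v → v < a + fuel →
    (∀ k → a ≤ k → k < v → P k ≡ false) → P v ≡ true → firstFrom P a fuel ≡ v
  firstFrom-unique a fuel v a≤v v<end before Pv with <-cmp (firstFrom P a fuel) v
  ... | tri≈ _ eq _ = eq
  ... | tri> _ _ v<w = contradiction (trans (sym Pv) (firstFrom-minimal a fuel v a≤v v<w)) true≢false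
  ... | tri< w<v _ _ with firstFrom-found a fuel
  ...   | inj₁ Pw  = contradiction (trans (sym Pw) (before _ (firstFrom-≥ a fuel) w<v)) true≢false
  ...   | inj₂ end = contradiction (<-trans w<v v<end) (<-irrefl end)

m∸n≡1+[m∸1+n] : ∀ {m n} → n < m → m ∸ n ≡ suc (m ∸ suc n)
m∸n≡1+[m∸1+n] {suc m} {zero}  _       = refl
m∸n≡1+[m∸1+n] {suc m} {suc n} (s≤s l) = m∸n≡1+[m∸1+n] l

ell-+-double : ∀ r x m → r ≤ x → ell r (x + 2 * m) ≡ ell r x + m
ell-+-double r x m r≤x = begin
  (x + 2 * m ∸ r) / 2       ≡⟨ cong (_/ 2) (+-∸-comm (2 * m) r≤x) ⟩
  (x ∸ r + 2 * m) / 2       ≡⟨ +-distrib-/-∣ʳ (x ∸ r) (m∣m*n m) ⟩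
  (x ∸ r) / 2 + 2 * m / 2   ≡⟨ cong ((x ∸ r) / 2 +_) (trans (cong (_/ 2) (*-comm 2 m)) (m*n/n≡m m 2)) ⟩
  (x ∸ r) / 2 + m           ∎
  where open ≡-Reasoning

infixl 6 _⊕_

_⊕_ : ℕ × ℕ → ℕ × ℕ → ℕ × ℕ
u ⊕ v = proj₁ u + proj₁ v , proj₂ u + proj₂ v

nN+nE≡index : ∀ P k → k ≤ length P → nN k P + nE k P ≡ k
nN+nE≡index P       zero    _       = refl
nN+nE≡index (N ∷ P) (suc k) (s≤s l) = cong suc (nN+nE≡index P k l)
nN+nE≡index (E ∷ P) (suc k) (s≤s l) = trans (+-suc _ _) (cong suc (nN+nE≡index P k l))

point-injective : ∀ P {a b} → a ≤ length P → b ≤ length P → point P a ≡ point P b → a ≡ b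
point-injective P {a} {b} a≤ b≤ eq = begin
  a                 ≡⟨ nN+nE≡index P a a≤ ⟨
  nN a P + nE a P   ≡⟨ cong₂ _+_ (cong proj₂ eq) (cong proj₁ eq) ⟩
  nN b P + nE b P   ≡⟨ nN+nE≡index P b b≤ ⟩
  b                 ∎
  where open ≡-Reasoning

point-beyond : ∀ P k → length P ≤ k → point P k ≡ point P (length P)
point-beyond []      zero    _       = refl
point-beyond []      (suc k) _       = refl
point-beyond (N ∷ P) (suc k) (s≤s l) = cong (map₂ suc) (point-beyond P k l)
point-beyond (E ∷ P) (suc k) (s≤s l) = cong (map₁ suc) (point-beyond P k l)

point-suc-N : ∀ P k → isNAt P k ≡ true → point P (suc k) ≡ map₂ suc (point P k)
point-suc-N (N ∷ P) zero    _ = refl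
point-suc-N (N ∷ P) (suc k) n = cong (map₂ suc) (point-suc-N P k n)
point-suc-N (E ∷ P) (suc k) n = cong (map₁ suc) (point-suc-N P k n)

point-suc-E : ∀ P k → isEAt P k ≡ true → point P (suc k) ≡ map₁ suc (point P k)
point-suc-E (E ∷ P) zero    _ = refl
point-suc-E (N ∷ P) (suc k) e = cong (map₂ suc) (point-suc-E P k e)
point-suc-E (E ∷ P) (suc k) e = cong (map₁ suc) (point-suc-E P k e)

isNAt⊎isEAt : ∀ P k → k < length P → isNAt P k ≡ true ⊎ isEAt P k ≡ true
isNAt⊎isEAt (N ∷ P) zero    _       = inj₁ refl
isNAt⊎isEAt (E ∷ P) zero    _       = inj₂ refl
isNAt⊎isEAt (N ∷ P) (suc k) (s≤s l) = isNAt⊎isEAt P k l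
isNAt⊎isEAt (E ∷ P) (suc k) (s≤s l) = isNAt⊎isEAt P k l

isNAt⇒¬isEAt : ∀ P k → isNAt P k ≡ true → isEAt P k ≡ false
isNAt⇒¬isEAt (N ∷ P) zero    _ = refl
isNAt⇒¬isEAt (N ∷ P) (suc k) n = isNAt⇒¬isEAt P k n
isNAt⇒¬isEAt (E ∷ P) (suc k) n = isNAt⇒¬isEAt P k n

isNAt⇒< : ∀ P k → isNAt P k ≡ true → k < length P
isNAt⇒< (N ∷ P) zero    _ = s≤s z≤n
isNAt⇒< (N ∷ P) (suc k) n = s≤s (isNAt⇒< P k n)
isNAt⇒< (E ∷ P) (suc k) n = s≤s (isNAt⇒< P k n)

isEAt⇒< : ∀ P k → isEAt P k ≡ true → k < length P
isEAt⇒< (E ∷ P) zero    _ = s≤s z≤n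
isEAt⇒< (N ∷ P) (suc k) e = s≤s (isEAt⇒< P k e)
isEAt⇒< (E ∷ P) (suc k) e = s≤s (isEAt⇒< P k e)

point-++ˡ : ∀ d s k → k ≤ length d → point (d ++ s) k ≡ point d k
point-++ˡ d       s zero    _       = refl
point-++ˡ (N ∷ d) s (suc k) (s≤s l) = cong (map₂ suc) (point-++ˡ d s k l)
point-++ˡ (E ∷ d) s (suc k) (s≤s l) = cong (map₁ suc) (point-++ˡ d s k l)

point-++ʳ : ∀ d s k → point (d ++ s) (length d + k) ≡ point d (length d) ⊕ point s k
point-++ʳ []      s k = refl
point-++ʳ (N ∷ d) s k = cong (map₂ suc) (point-++ʳ d s k)
point-++ʳ (E ∷ d) s k = cong (map₁ suc) (point-++ʳ d s k)

isNAt-++ˡ : ∀ d s k → k < length d → isNAt (d ++ s) k ≡ isNAt d k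
isNAt-++ˡ (N ∷ d) s zero    _       = refl
isNAt-++ˡ (E ∷ d) s zero    _       = refl
isNAt-++ˡ (N ∷ d) s (suc k) (s≤s l) = isNAt-++ˡ d s k l
isNAt-++ˡ (E ∷ d) s (suc k) (s≤s l) = isNAt-++ˡ d s k l

isEAt-++ˡ : ∀ d s k → k < length d → isEAt (d ++ s) k ≡ isEAt d k
isEAt-++ˡ (N ∷ d) s zero    _       = refl
isEAt-++ˡ (E ∷ d) s zero    _       = refl
isEAt-++ˡ (N ∷ d) s (suc k) (s≤s l) = isEAt-++ˡ d s k l
isEAt-++ˡ (E ∷ d) s (suc k) (s≤s l) = isEAt-++ˡ d s k l

isNAt-++ʳ : ∀ d s k → isNAt (d ++ s) (length d + k) ≡ isNAt s k
isNAt-++ʳ []      s k = refl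
isNAt-++ʳ (N ∷ d) s k = isNAt-++ʳ d s k
isNAt-++ʳ (E ∷ d) s k = isNAt-++ʳ d s k

isEAt-++ʳ : ∀ d s k → isEAt (d ++ s) (length d + k) ≡ isEAt s k
isEAt-++ʳ []      s k = refl
isEAt-++ʳ (N ∷ d) s k = isEAt-++ʳ d s k
isEAt-++ʳ (E ∷ d) s k = isEAt-++ʳ d s k

nthN-isNAt : ∀ P c → c < nN (length P) P → isNAt P (nthN P c) ≡ true
nthN-isNAt (N ∷ P) zero    _       = refl
nthN-isNAt (N ∷ P) (suc c) (s≤s l) = nthN-isNAt P c l
nthN-isNAt (E ∷ P) c       l       = nthN-isNAt P c l

nN-nthN : ∀ P c → c < nN (length P) P → nN (nthN P c) P ≡ c
nN-nthN (N ∷ P) zero    _       = refl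
nN-nthN (N ∷ P) (suc c) (s≤s l) = cong suc (nN-nthN P c l)
nN-nthN (E ∷ P) c       l       = nN-nthN P c l

nthN-unique : ∀ P k → isNAt P k ≡ true → nthN P (nN k P) ≡ k
nthN-unique (N ∷ P) zero    _ = refl
nthN-unique (N ∷ P) (suc k) n = cong suc (nthN-unique P k n)
nthN-unique (E ∷ P) (suc k) n = cong suc (nthN-unique P k n)

level : ℕ × ℕ → ℕ
level (x , y) = y ∸ x

hdist : Path → ℕ → ℕ
hdist P k = level (point P k)

Above : Path → Set
Above P = ∀ k → nE k P ≤ nN k P

module _ {P : Path} (above : Above P) where

  horiz≡hdist : ∀ k → horiz P k ≡ ℤ.+ hdist P k
  horiz≡hdist k = trans (ℤᵖ.m-n≡m⊖n (nN k P) (nE k P)) (ℤᵖ.⊖-≥ (above k))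

  sameHoriz-true : ∀ r k → hdist P k ≡ hdist P r → sameHoriz P r k ≡ true
  sameHoriz-true r k eq = isYes-true (horiz P k ℤ.≟ horiz P r)
    (trans (horiz≡hdist k) (trans (cong ℤ.+_ eq) (sym (horiz≡hdist r))))

  sameHoriz-false : ∀ r k → hdist P k ≢ hdist P r → sameHoriz P r k ≡ false
  sameHoriz-false r k neq = isYes-false (horiz P k ℤ.≟ horiz P r)
    (λ eq → neq (ℤᵖ.+-injective (trans (sym (horiz≡hdist k)) (trans eq (horiz≡hdist r)))))

  sameHoriz-sound : ∀ r k → sameHoriz P r k ≡ true → hdist P k ≡ hdist P r
  sameHoriz-sound r k same = ℤᵖ.+-injective (trans (sym (horiz≡hdist k))
    (trans (isYes-sound (horiz P k ℤ.≟ horiz P r) same) (horiz≡hdist r)))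

  hdist-suc-N : ∀ k → isNAt P k ≡ true → hdist P (suc k) ≡ suc (hdist P k)
  hdist-suc-N k n = trans (cong level (point-suc-N P k n)) (+-∸-assoc 1 (above k))

  hdist-suc-E : ∀ k → isEAt P k ≡ true → hdist P k ≡ suc (hdist P (suc k))
  hdist-suc-E k e = trans (m∸n≡1+[m∸1+n] lt) (cong suc (cong level (sym (point-suc-E P k e))))
    where
    lt : suc (nE k P) ≤ nN k P
    lt = subst (λ (x , y) → x ≤ y) (point-suc-E P k e) (above (suc k))

  hdist-step : ∀ k → k < length P →
    (isNAt P k ≡ true × hdist P (suc k) ≡ suc (hdist P k)) ⊎
    (isEAt P k ≡ true × hdist P k ≡ suc (hdist P (suc k)))
  hdist-step k k< with isNAt⊎isEAt P k k<
  ... | inj₁ n = inj₁ (n , hdist-suc-N k n)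
  ... | inj₂ e = inj₂ (e , hdist-suc-E k e)

  index≡hdist+2*nE : ∀ k → k ≤ length P → k ≡ hdist P k + 2 * nE k P
  index≡hdist+2*nE k k≤ = begin
    k                                ≡⟨ nN+nE≡index P k k≤ ⟨
    nN k P + nE k P                  ≡⟨ cong (_+ nE k P) (m∸n+n≡m (above k)) ⟨
    hdist P k + nE k P + nE k P      ≡⟨ +-assoc (hdist P k) _ _ ⟩
    hdist P k + (nE k P + nE k P)    ≡⟨ cong (λ x → hdist P k + (nE k P + x)) (+-identityʳ _) ⟨
    hdist P k + 2 * nE k P           ∎
    where open ≡-Reasoning

  even-gap : ∀ {a b} → a ≤ b → b ≤ length P → hdist P a ≡ hdist P b → ∃ λ m → b ≡ a + 2 * m
  even-gap {a} {b} a≤b b≤ same = nE b P ∸ nE a P , (begin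
    b                                          ≡⟨ index≡hdist+2*nE b b≤ ⟩
    h + 2 * nE b P                             ≡⟨ cong (λ x → h + 2 * x) (m+[n∸m]≡n nEa≤nEb) ⟨
    h + 2 * (nE a P + (nE b P ∸ nE a P))       ≡⟨ cong (h +_) (*-distribˡ-+ 2 (nE a P) _) ⟩
    h + (2 * nE a P + 2 * (nE b P ∸ nE a P))   ≡⟨ +-assoc h _ _ ⟨
    h + 2 * nE a P + 2 * (nE b P ∸ nE a P)     ≡⟨ cong (_+ 2 * (nE b P ∸ nE a P)) a≡ ⟨
    a + 2 * (nE b P ∸ nE a P)                  ∎)
    where
    open ≡-Reasoning
    h = hdist P b
    a≡ : a ≡ h + 2 * nE a P
    a≡ = trans (index≡hdist+2*nE a (≤-trans a≤b b≤)) (cong (_+ 2 * nE a P) same)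
    nEa≤nEb : nE a P ≤ nE b P
    nEa≤nEb = *-cancelˡ-≤ 2 (+-cancelˡ-≤ h _ _ (subst₂ _≤_ a≡ (index≡hdist+2*nE b b≤) a≤b))

  above-until-level : ∀ {r v} → isNAt P r ≡ true →
    (∀ k → r < k → k < v → hdist P k ≢ hdist P r) →
    ∀ k → r < k → k < v → k ≤ length P → hdist P r < hdist P k
  above-until-level {r} north no-touch (suc k) (s≤s r≤k) k<v k< with m≤n⇒m<n∨m≡n r≤k
  ... | inj₂ refl = ≤-reflexive (sym (hdist-suc-N r north))
  ... | inj₁ r<k with hdist-step k k< | above-until-level north no-touch k r<k (<-trans (n<1+n k) k<v) (<⇒≤ k<)
  ...   | inj₁ (_ , up)   | ih = <-trans ih (≤-reflexive (sym up))
  ...   | inj₂ (_ , down) | ih = ≤∧≢⇒< (s≤s⁻¹ (≤-trans ih (≤-reflexive down)))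
                                      (λ eq → no-touch (suc k) (s≤s r≤k) k<v (sym eq))

  above-until-hit : ∀ {r v} → isNAt P r ≡ true →
    (∀ k → r < k → k < v → hdist P k ≡ hdist P r → isEAt P k ≡ false) →
    ∀ k → r < k → k ≤ v → k ≤ length P → hdist P r ≤ hdist P k
  above-until-hit {r} north no-hit (suc k) (s≤s r≤k) k≤v k< with m≤n⇒m<n∨m≡n r≤k
  ... | inj₂ refl = ≤-trans (n≤1+n _) (≤-reflexive (sym (hdist-suc-N r north)))
  ... | inj₁ r<k with hdist-step k k< | above-until-hit north no-hit k r<k (<⇒≤ k≤v) (<⇒≤ k<)
  ...   | inj₁ (_ , up)      | ih = ≤-trans ih (≤-trans (n≤1+n _) (≤-reflexive (sym up)))
  ...   | inj₂ (east , down) | ih with hdist P k ≟ hdist P r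
  ...     | yes same = contradiction (trans (sym east) (no-hit k r<k k≤v same)) true≢false
  ...     | no differ = s≤s⁻¹ (≤-trans (≤∧≢⇒< ih (differ ∘ sym)) (≤-reflexive down))

touchFrom : Path → ℕ → ℕ
touchFrom P r = firstFrom (sameHoriz P r) (suc r) (length P ∸ r)

hitTest : Path → ℕ → ℕ → Bool
hitTest P r q = sameHoriz P r q ∧ (⌊ q ≟ length P ⌋ ∨ isEAt P q)

hitFrom : Path → ℕ → ℕ
hitFrom P r = firstFrom (hitTest P r) (suc r) (length P ∸ r)

record Touch (P : Path) (r v : ℕ) : Set where
  field
    r<v          : r < v
    v≤length     : v ≤ length P
    level-v      : hdist P v ≡ hdist P r
    no-touch-before : ∀ k → r < k → k < v → hdist P k ≢ hdist P r

record Hit (P : Path) (r v : ℕ) : Set where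
  field
    r<v       : r < v
    v≤length  : v ≤ length P
    level-v   : hdist P v ≡ hdist P r
    final     : v ≡ length P ⊎ isEAt P v ≡ true
    no-hit-before : ∀ k → r < k → k < v → hdist P k ≡ hdist P r → isEAt P k ≡ false

<-length-after : ∀ {r v L} → r < v → v ≤ L → v < suc r + (L ∸ r)
<-length-after {r} r<v v≤L = s≤s (≤-trans v≤L (≤-reflexive (sym (m+[n∸m]≡n (≤-trans (<⇒≤ r<v) v≤L)))))

module _ {P : Path} (above : Above P) where

  touchFrom-unique : ∀ {r v} → Touch P r v → touchFrom P r ≡ v
  touchFrom-unique {r} {v} t = firstFrom-unique (sameHoriz P r) (suc r) (length P ∸ r) v r<v
    (<-length-after r<v v≤length) (λ k r<k k<v → sameHoriz-false above r k (no-touch-before k r<k k<v))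
    (sameHoriz-true above r v level-v)
    where open Touch t

  hitFrom-unique : ∀ {r v} → Hit P r v → hitFrom P r ≡ v
  hitFrom-unique {r} {v} h = firstFrom-unique (hitTest P r) (suc r) (length P ∸ r) v r<v
    (<-length-after r<v v≤length) earlier found
    where
    open Hit h
    earlier : ∀ k → r < k → k < v → hitTest P r k ≡ false
    earlier k r<k k<v with hdist P k ≟ hdist P r
    ... | no differ = cong (_∧ _) (sameHoriz-false above r k differ)
    ... | yes same  = trans (cong₂ (λ a b → sameHoriz P r k ∧ (a ∨ b))
                              (isYes-false (k ≟ length P) (<⇒≢ (<-≤-trans k<v v≤length)))
                              (no-hit-before k r<k k<v same))
                            (∧-zeroʳ _)
    found : hitTest P r v ≡ true
    found with final
    ... | inj₁ atEnd = cong₂ (λ a b → a ∧ (b ∨ isEAt P v))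
                         (sameHoriz-true above r v level-v) (isYes-true (v ≟ length P) atEnd)
    ... | inj₂ east  = trans (cong₂ (λ a b → a ∧ (⌊ v ≟ length P ⌋ ∨ b))
                         (sameHoriz-true above r v level-v) east) (∨-zeroʳ _)

  Touch-above : ∀ {r v} → isNAt P r ≡ true → Touch P r v → ∀ k → r < k → k < v → hdist P r < hdist P k
  Touch-above north t k r<k k<v =
    above-until-level above north no-touch-before k r<k k<v (≤-trans (<⇒≤ k<v) v≤length)
    where open Touch t

  Hit-above : ∀ {r v} → isNAt P r ≡ true → Hit P r v → ∀ k → r < k → k ≤ v → hdist P r ≤ hdist P k
  Hit-above north t k r<k k≤v = above-until-hit above north no-hit-before k r<k k≤v (≤-trans k≤v v≤length)
    where open Hit t

module _ {P Q : Path} (same-length : length Q ≡ length P) where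

  Touch-transport : ∀ {r v} → (∀ k → r ≤ k → k ≤ v → hdist Q k ≡ hdist P k) → Touch P r v → Touch Q r v
  Touch-transport {r} {v} same t = record
    { r<v = r<v
    ; v≤length = subst (v ≤_) (sym same-length) v≤length
    ; level-v = trans (same v (<⇒≤ r<v) ≤-refl) (trans level-v (sym (same r ≤-refl (<⇒≤ r<v))))
    ; no-touch-before = λ k r<k k<v eq → no-touch-before k r<k k<v
        (trans (sym (same k (<⇒≤ r<k) (<⇒≤ k<v))) (trans eq (same r ≤-refl (<⇒≤ r<v))))
    }
    where open Touch t

  Touch-shift : ∀ {r v} → (∀ k → r ≤ k → k ≤ v → hdist Q k ≡ suc (hdist P (suc k))) →
    Touch P (suc r) (suc v) → Touch Q r v
  Touch-shift {r} {v} shifted t = record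
    { r<v = s≤s⁻¹ r<v
    ; v≤length = subst (v ≤_) (sym same-length) (<⇒≤ v≤length)
    ; level-v = trans (shifted v r≤v ≤-refl) (trans (cong suc level-v) (sym (shifted r ≤-refl r≤v)))
    ; no-touch-before = λ k r<k k<v eq → no-touch-before (suc k) (s≤s r<k) (s≤s k<v) (suc-injective
        (trans (sym (shifted k (<⇒≤ r<k) (<⇒≤ k<v))) (trans eq (shifted r ≤-refl r≤v))))
    }
    where
    open Touch t
    r≤v : r ≤ v
    r≤v = <⇒≤ (s≤s⁻¹ r<v)

  Hit-transport : ∀ {r v} → (∀ k → r ≤ k → k ≤ v → hdist Q k ≡ hdist P k) →
    (∀ k → r < k → k ≤ v → k < length P → isEAt Q k ≡ isEAt P k) → Hit P r v → Hit Q r v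
  Hit-transport {r} {v} same sameStep t = record
    { r<v = r<v
    ; v≤length = subst (v ≤_) (sym same-length) v≤length
    ; level-v = trans (same v (<⇒≤ r<v) ≤-refl) (trans level-v (sym (same r ≤-refl (<⇒≤ r<v))))
    ; final = final′
    ; no-hit-before = λ k r<k k<v eq → trans (sameStep k r<k (<⇒≤ k<v) (<-≤-trans k<v v≤length))
        (no-hit-before k r<k k<v (trans (sym (same k (<⇒≤ r<k) (<⇒≤ k<v))) (trans eq (same r ≤-refl (<⇒≤ r<v)))))
    }
    where
    open Hit t
    final′ : v ≡ length Q ⊎ isEAt Q v ≡ true
    final′ with final
    ... | inj₁ atEnd = inj₁ (trans atEnd (sym same-length))
    ... | inj₂ east  = inj₂ (trans (sameStep v r<v ≤-refl (isEAt⇒< P v east)) east)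

  Hit-shift : ∀ {r v} → (∀ k → r ≤ k → k ≤ v → hdist Q k ≡ suc (hdist P (suc k))) →
    (∀ k → r < k → k < v → isEAt Q k ≡ isEAt P (suc k)) → v ≡ length Q ⊎ isEAt Q v ≡ true →
    Hit P (suc r) (suc v) → Hit Q r v
  Hit-shift {r} {v} shifted shiftedStep final′ t = record
    { r<v = s≤s⁻¹ r<v
    ; v≤length = subst (v ≤_) (sym same-length) (<⇒≤ v≤length)
    ; level-v = trans (shifted v r≤v ≤-refl) (trans (cong suc level-v) (sym (shifted r ≤-refl r≤v)))
    ; final = final′
    ; no-hit-before = λ k r<k k<v eq → trans (shiftedStep k r<k k<v)
        (no-hit-before (suc k) (s≤s r<k) (s≤s k<v)
          (suc-injective (trans (sym (shifted k (<⇒≤ r<k) (<⇒≤ k<v))) (trans eq (shifted r ≤-refl r≤v)))))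
    }
    where
    open Hit t
    r≤v : r ≤ v
    r≤v = <⇒≤ (s≤s⁻¹ r<v)

module DyckPath {N₀ : ℕ} {D : Path} (dyck : IsDyck N₀ D) where

  open IsDyck dyck

  above : Above D
  above k with k ≤? length D
  ... | yes k≤ = aboveNu k k≤
  ... | no  k≰ = subst (λ (x , y) → x ≤ y) (sym (point-beyond D k (≰⇒≥ k≰))) (aboveNu (length D) ≤-refl)

  hdist-end : hdist D (length D) ≡ 0
  hdist-end = trans (cong₂ _∸_ northCount eastCount) (n∸n≡0 N₀)

  module _ {r : ℕ} (north : isNAt D r ≡ true) where

    private
      r<length : r < length D
      r<length = isNAt⇒< D r north

      beyond-length : ∀ {v} → v ≡ suc r + (length D ∸ r) → length D < v
      beyond-length refl = <-length-after r<length ≤-refl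

    touchFrom-touch : Touch D r (touchFrom D r)
    touchFrom-touch = record
      { r<v = firstFrom-≥ (sameHoriz D r) (suc r) (length D ∸ r)
      ; v≤length = T≤length
      ; level-v = level-T
      ; no-touch-before = no-touch-before′
      }
      where
      T : ℕ
      T = touchFrom D r
      no-touch-before′ : ∀ k → r < k → k < T → hdist D k ≢ hdist D r
      no-touch-before′ k r<k k<T same = true≢false
        (trans (sym (sameHoriz-true above r k same))
               (firstFrom-minimal (sameHoriz D r) (suc r) (length D ∸ r) k r<k k<T))
      T≤length : T ≤ length D
      T≤length with T ≤? length D
      ... | yes T≤ = T≤
      ... | no  T≰ = ⊥-elim (n≮0 (subst (hdist D r <_) hdist-end
        (above-until-level above north no-touch-before′ (length D) r<length (≰⇒> T≰) ≤-refl)))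
      level-T : hdist D T ≡ hdist D r
      level-T with firstFrom-found (sameHoriz D r) (suc r) (length D ∸ r)
      ... | inj₁ found = sameHoriz-sound above r T found
      ... | inj₂ atEnd = contradiction T≤length (<⇒≱ (beyond-length atEnd))

    hitFrom-hit : Hit D r (hitFrom D r)
    hitFrom-hit = record
      { r<v = firstFrom-≥ (hitTest D r) (suc r) (length D ∸ r)
      ; v≤length = H≤length
      ; level-v = sameHoriz-sound above r H (∧-conicalˡ _ _ found)
      ; final = final
      ; no-hit-before = no-hit-before
      }
      where
      H : ℕ
      H = hitFrom D r
      missed : ∀ k → r < k → k < H → hitTest D r k ≡ false
      missed = firstFrom-minimal (hitTest D r) (suc r) (length D ∸ r)
      no-hit-before : ∀ k → r < k → k < H → hdist D k ≡ hdist D r → isEAt D k ≡ false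
      no-hit-before k r<k k<H same = ∨-conicalʳ _ _
        (trans (cong (_∧ _) (sym (sameHoriz-true above r k same))) (missed k r<k k<H))
      H≤length : H ≤ length D
      H≤length with H ≤? length D
      ... | yes H≤ = H≤
      ... | no  H≰ = ⊥-elim (true≢false (trans (sym end-hit) (missed (length D) r<length (≰⇒> H≰))))
        where
        r-at-ground : hdist D r ≡ 0
        r-at-ground = n≤0⇒n≡0 (subst (hdist D r ≤_) hdist-end
          (above-until-hit above north no-hit-before (length D) r<length (<⇒≤ (≰⇒> H≰)) ≤-refl))
        end-hit : hitTest D r (length D) ≡ true
        end-hit = cong₂ (λ a b → a ∧ (b ∨ isEAt D (length D)))
          (sameHoriz-true above r (length D) (trans hdist-end (sym r-at-ground)))
          (isYes-true (length D ≟ length D) refl)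
      found : hitTest D r H ≡ true
      found with firstFrom-found (hitTest D r) (suc r) (length D ∸ r)
      ... | inj₁ hit   = hit
      ... | inj₂ atEnd = contradiction H≤length (<⇒≱ (beyond-length atEnd))
      final : H ≡ length D ⊎ isEAt D H ≡ true
      final with ∨-true _ _ (∧-conicalʳ _ _ found)
      ... | inj₁ atEnd = inj₁ (isYes-sound (H ≟ length D) atEnd)
      ... | inj₂ east  = inj₂ east

⊕-map₁-suc : ∀ u v → u ⊕ map₁ suc v ≡ map₁ suc (u ⊕ v)
⊕-map₁-suc u v = cong (_, proj₂ u + proj₂ v) (+-suc (proj₁ u) (proj₁ v))

module Swap (d h f : Path) where

  before after : Path
  before = d ++ E ∷ h ++ f
  after  = d ++ h ++ E ∷ f

  private
    suffix-index : ∀ b → suc (length d + length h) + b ≡ length d + suc (length h + b)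
    suffix-index b = trans (cong suc (+-assoc (length d) (length h) b)) (sym (+-suc (length d) (length h + b)))

  length-swap : length after ≡ length before
  length-swap = begin
    length after                         ≡⟨ length-++ d ⟩
    length d + length (h ++ E ∷ f)      ≡⟨ cong (length d +_) (length-++ h) ⟩
    length d + (length h + suc (length f)) ≡⟨ cong (length d +_) (+-suc (length h) _) ⟩
    length d + suc (length h + length f) ≡⟨ cong (λ x → length d + suc x) (length-++ h) ⟨
    length d + length (E ∷ h ++ f)      ≡⟨ length-++ d ⟨
    length before                        ∎
    where open ≡-Reasoning

  point-swap-prefix : ∀ k → k ≤ length d → point after k ≡ point before k
  point-swap-prefix k k≤ = trans (point-++ˡ d _ k k≤) (sym (point-++ˡ d _ k k≤))

  point-swap-inside : ∀ k → length d ≤ k → k ≤ length d + length h →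
    point before (suc k) ≡ map₁ suc (point after k)
  point-swap-inside k d≤k k≤ with m≤n⇒∃[o]m+o≡n d≤k
  ... | a , refl = begin
    point before (suc (length d + a))          ≡⟨ cong (point before) (+-suc (length d) a) ⟨
    point before (length d + suc a)            ≡⟨ point-++ʳ d _ (suc a) ⟩
    pd ⊕ map₁ suc (point (h ++ f) a)           ≡⟨ cong (λ p → pd ⊕ map₁ suc p) (point-++ˡ h f a a≤) ⟩
    pd ⊕ map₁ suc (point h a)                  ≡⟨ ⊕-map₁-suc pd (point h a) ⟩
    map₁ suc (pd ⊕ point h a)                  ≡⟨ cong (λ p → map₁ suc (pd ⊕ p)) (point-++ˡ h _ a a≤) ⟨
    map₁ suc (pd ⊕ point (h ++ E ∷ f) a)       ≡⟨ cong (map₁ suc) (point-++ʳ d _ a) ⟨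
    map₁ suc (point after (length d + a))      ∎
    where
    open ≡-Reasoning
    pd : ℕ × ℕ
    pd = point d (length d)
    a≤ : a ≤ length h
    a≤ = +-cancelˡ-≤ (length d) a (length h) k≤

  point-swap-suffix : ∀ k → length d + length h < k → point after k ≡ point before k
  point-swap-suffix k dh<k with m≤n⇒∃[o]m+o≡n dh<k
  ... | b , refl = begin
    point after (suc (ld + lh) + b)
      ≡⟨ cong (point after) (trans (suffix-index b) (cong (ld +_) (sym (+-suc lh b)))) ⟩
    point after (ld + (lh + suc b))                ≡⟨ point-++ʳ d _ _ ⟩
    pd ⊕ point (h ++ E ∷ f) (lh + suc b)           ≡⟨ cong (pd ⊕_) (point-++ʳ h _ (suc b)) ⟩
    pd ⊕ (point h lh ⊕ map₁ suc (point f b))       ≡⟨ cong (pd ⊕_) (⊕-map₁-suc (point h lh) (point f b)) ⟩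
    pd ⊕ map₁ suc (point h lh ⊕ point f b)         ≡⟨ cong (λ p → pd ⊕ map₁ suc p) (point-++ʳ h f b) ⟨
    pd ⊕ point (E ∷ h ++ f) (suc (lh + b))         ≡⟨ point-++ʳ d _ _ ⟨
    point before (ld + suc (lh + b))               ≡⟨ cong (point before) (suffix-index b) ⟨
    point before (suc (ld + lh) + b)               ∎
    where
    open ≡-Reasoning
    ld lh : ℕ
    ld = length d
    lh = length h
    pd : ℕ × ℕ
    pd = point d ld

  module StepSwap (at : Path → ℕ → Bool)
    (at-++ˡ : ∀ d s k → k < length d → at (d ++ s) k ≡ at d k)
    (at-++ʳ : ∀ d s k → at (d ++ s) (length d + k) ≡ at s k) where

    private
      at-cons : ∀ x s k → at (x ∷ s) (suc k) ≡ at s k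
      at-cons x = at-++ʳ (x ∷ [])

    at-swap-prefix : ∀ k → k < length d → at after k ≡ at before k
    at-swap-prefix k k< = trans (at-++ˡ d _ k k<) (sym (at-++ˡ d _ k k<))

    at-swap-inside : ∀ k → length d ≤ k → k < length d + length h → at after k ≡ at before (suc k)
    at-swap-inside k d≤k k< with m≤n⇒∃[o]m+o≡n d≤k
    ... | a , refl = begin
      at after (length d + a)        ≡⟨ at-++ʳ d _ a ⟩
      at (h ++ E ∷ f) a              ≡⟨ at-++ˡ h _ a a< ⟩
      at h a                         ≡⟨ at-++ˡ h f a a< ⟨
      at (h ++ f) a                  ≡⟨ at-cons E (h ++ f) a ⟨
      at (E ∷ h ++ f) (suc a)        ≡⟨ at-++ʳ d _ (suc a) ⟨
      at before (length d + suc a)   ≡⟨ cong (at before) (+-suc (length d) a) ⟩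
      at before (suc (length d + a)) ∎
      where
      open ≡-Reasoning
      a< : a < length h
      a< = +-cancelˡ-< (length d) a (length h) k<

    at-swap-suffix : ∀ k → length d + length h < k → at after k ≡ at before k
    at-swap-suffix k dh<k with m≤n⇒∃[o]m+o≡n dh<k
    ... | b , refl = begin
      at after (suc (ld + lh) + b)
        ≡⟨ cong (at after) (trans (suffix-index b) (cong (ld +_) (sym (+-suc lh b)))) ⟩
      at after (ld + (lh + suc b))   ≡⟨ at-++ʳ d _ _ ⟩
      at (h ++ E ∷ f) (lh + suc b)   ≡⟨ at-++ʳ h _ (suc b) ⟩
      at (E ∷ f) (suc b)             ≡⟨ at-cons E f b ⟩
      at f b                         ≡⟨ at-++ʳ h f b ⟨
      at (h ++ f) (lh + b)           ≡⟨ at-cons E (h ++ f) (lh + b) ⟨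
      at (E ∷ h ++ f) (suc (lh + b)) ≡⟨ at-++ʳ d _ _ ⟨
      at before (ld + suc (lh + b))  ≡⟨ cong (at before) (suffix-index b) ⟨
      at before (suc (ld + lh) + b)  ∎
      where
      open ≡-Reasoning
      ld lh : ℕ
      ld = length d
      lh = length h

  open StepSwap isNAt isNAt-++ˡ isNAt-++ʳ public
    renaming (at-swap-prefix to isNAt-swap-prefix; at-swap-inside to isNAt-swap-inside;
              at-swap-suffix to isNAt-swap-suffix)
  open StepSwap isEAt isEAt-++ˡ isEAt-++ʳ public
    renaming (at-swap-prefix to isEAt-swap-prefix; at-swap-inside to isEAt-swap-inside;
              at-swap-suffix to isEAt-swap-suffix)

  isEAt-swap-moved : isEAt after (length d + length h) ≡ true
  isEAt-swap-moved = begin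
    isEAt after (length d + length h)      ≡⟨ isEAt-++ʳ d _ (length h) ⟩
    isEAt (h ++ E ∷ f) (length h)          ≡⟨ cong (isEAt (h ++ E ∷ f)) (+-identityʳ (length h)) ⟨
    isEAt (h ++ E ∷ f) (length h + 0)      ≡⟨ isEAt-++ʳ h (E ∷ f) 0 ⟩
    true                                   ∎
    where open ≡-Reasoning

drop-east : ∀ (P : Path) k → isEAt P k ≡ true → drop k P ≡ E ∷ drop (suc k) P
drop-east (E ∷ P) zero    _ = refl
drop-east (N ∷ P) (suc k) e = drop-east P k e
drop-east (E ∷ P) (suc k) e = drop-east P k e

drop≡drop-take++drop : ∀ (P : Path) {a b} → a ≤ b → drop a P ≡ drop a (take b P) ++ drop b P
drop≡drop-take++drop P       {zero}  {b}     _       = sym (take++drop≡id b P)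
drop≡drop-take++drop []      {suc a} {suc b} _       = refl
drop≡drop-take++drop (s ∷ P) {suc a} {suc b} (s≤s l) = drop≡drop-take++drop P l

ShiftClaim : Path → ℕ → ℕ → ℕ → ℕ → ℕ → Set
ShiftClaim P a b new old extra =
  (point P a ≢ point P b → new ≡ old) × (point P a ≡ point P b → new ≡ old + extra)

ShiftClaim-unchanged : ∀ {P a b new old} extra → a ≤ length P → b ≤ length P → a ≢ b →
  new ≡ old → ShiftClaim P a b new old extra
ShiftClaim-unchanged {P} _ a≤ b≤ a≢b eq = (λ _ → eq) , (λ same → contradiction (point-injective P a≤ b≤ same) a≢b)

ShiftClaim-extended : ∀ {P a b new old extra} → a ≡ b → new ≡ old + extra → ShiftClaim P a b new old extra
ShiftClaim-extended refl eq = (λ differ → contradiction refl differ) , (λ _ → eq)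

module Greedy {N₀ : ℕ} {D : Path} (dyck : IsDyck N₀ D) (i : ℕ) (defined : GreedyDefined D i) where

  open DyckPath dyck

  rᵢ hᵢ : ℕ
  rᵢ = rPos D i
  hᵢ = hPos D i

  north-rᵢ : isNAt D rᵢ ≡ true
  north-rᵢ = proj₂ (proj₂ defined)

  hit-rᵢ : Hit D rᵢ hᵢ
  hit-rᵢ = hitFrom-hit north-rᵢ

  d h f : Path
  d = take (rᵢ ∸ 1) D
  h = drop rᵢ (take hᵢ D)
  f = drop hᵢ D

  open Swap d h f

  U : Path
  U = greedyUp D i

  rᵢ≡1+[rᵢ∸1] : rᵢ ≡ suc (rᵢ ∸ 1)
  rᵢ≡1+[rᵢ∸1] = sym (trans (+-comm 1 (rᵢ ∸ 1)) (m∸n+n≡m (proj₁ defined)))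

  D≡before : D ≡ before
  D≡before = begin
    D                                          ≡⟨ take++drop≡id (rᵢ ∸ 1) D ⟨
    d ++ drop (rᵢ ∸ 1) D                       ≡⟨ cong (d ++_) (drop-east D (rᵢ ∸ 1) (proj₁ (proj₂ defined))) ⟩
    d ++ E ∷ drop (suc (rᵢ ∸ 1)) D             ≡⟨ cong (λ k → d ++ E ∷ drop k D) rᵢ≡1+[rᵢ∸1] ⟨
    d ++ E ∷ drop rᵢ D                         ≡⟨ cong (λ t → d ++ E ∷ t) (drop≡drop-take++drop D (<⇒≤ (Hit.r<v hit-rᵢ))) ⟩
    before                                     ∎
    where open ≡-Reasoning

  open Hit hit-rᵢ using () renaming (r<v to rᵢ<hᵢ; v≤length to hᵢ≤length)

  x x′ : ℕ
  x  = length d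
  x′ = x + length h

  x≡rᵢ∸1 : x ≡ rᵢ ∸ 1
  x≡rᵢ∸1 = trans (length-take (rᵢ ∸ 1) D) (m≤n⇒m⊓n≡m (≤-trans (m∸n≤m rᵢ 1) (<⇒≤ (<-≤-trans rᵢ<hᵢ hᵢ≤length))))

  rᵢ≡1+x : rᵢ ≡ suc x
  rᵢ≡1+x = trans rᵢ≡1+[rᵢ∸1] (cong suc (sym x≡rᵢ∸1))

  hᵢ≡1+x′ : hᵢ ≡ suc x′
  hᵢ≡1+x′ = begin
    hᵢ                    ≡⟨ m+[n∸m]≡n (<⇒≤ rᵢ<hᵢ) ⟨
    rᵢ + (hᵢ ∸ rᵢ)        ≡⟨ cong₂ _+_ rᵢ≡1+x (sym length-h) ⟩
    suc x′                ∎
    where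
    open ≡-Reasoning
    length-h : length h ≡ hᵢ ∸ rᵢ
    length-h = trans (length-drop rᵢ (take hᵢ D)) (cong (_∸ rᵢ) (trans (length-take hᵢ D) (m≤n⇒m⊓n≡m hᵢ≤length)))

  rᵢ≤suc : ∀ {k} → x ≤ k → rᵢ ≤ suc k
  rᵢ≤suc x≤k = subst (_≤ suc _) (sym rᵢ≡1+x) (s≤s x≤k)

  suc≤hᵢ : ∀ {k} → k ≤ x′ → suc k ≤ hᵢ
  suc≤hᵢ k≤x′ = subst (suc _ ≤_) (sym hᵢ≡1+x′) (s≤s k≤x′)

  hᵢ≤ : ∀ {k} → x′ < k → hᵢ ≤ k
  hᵢ≤ x′<k = subst (_≤ _) (sym hᵢ≡1+x′) x′<k

  ≤x′ : ∀ {k} → k < hᵢ → k ≤ x′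
  ≤x′ k<hᵢ = s≤s⁻¹ (subst (_ <_) hᵢ≡1+x′ k<hᵢ)

  x<rᵢ : x < rᵢ
  x<rᵢ = ≤-reflexive (sym rᵢ≡1+x)

  x≤x′ : x ≤ x′
  x≤x′ = m≤m+n x (length h)

  x′<hᵢ : x′ < hᵢ
  x′<hᵢ = ≤-reflexive (sym hᵢ≡1+x′)

  rᵢ≤x′ : rᵢ ≤ x′
  rᵢ≤x′ = ≤x′ rᵢ<hᵢ

  rᵢ≤length : rᵢ ≤ length D
  rᵢ≤length = <⇒≤ (<-≤-trans rᵢ<hᵢ hᵢ≤length)

  rᵢ∸1≤length : rᵢ ∸ 1 ≤ length D
  rᵢ∸1≤length = ≤-trans (m∸n≤m rᵢ 1) rᵢ≤length

  private
    inD : ∀ {A : Set} (F : Path → A) → F before ≡ F D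
    inD F = cong F (sym D≡before)

  length-U : length U ≡ length D
  length-U = trans length-swap (inD length)

  point-U-prefix : ∀ k → k ≤ x → point U k ≡ point D k
  point-U-prefix k k≤x = trans (point-swap-prefix k k≤x) (inD (λ P → point P k))

  point-U-inside : ∀ k → x ≤ k → k ≤ x′ → point D (suc k) ≡ map₁ suc (point U k)
  point-U-inside k x≤k k≤x′ = trans (sym (inD (λ P → point P (suc k)))) (point-swap-inside k x≤k k≤x′)

  point-U-suffix : ∀ k → x′ < k → point U k ≡ point D k
  point-U-suffix k x′<k = trans (point-swap-suffix k x′<k) (inD (λ P → point P k))

  isNAt-U-prefix : ∀ k → k < x → isNAt U k ≡ isNAt D k
  isNAt-U-prefix k k<x = trans (isNAt-swap-prefix k k<x) (inD (λ P → isNAt P k))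

  isNAt-U-inside : ∀ k → x ≤ k → k < x′ → isNAt U k ≡ isNAt D (suc k)
  isNAt-U-inside k x≤k k<x′ = trans (isNAt-swap-inside k x≤k k<x′) (inD (λ P → isNAt P (suc k)))

  isNAt-U-suffix : ∀ k → x′ < k → isNAt U k ≡ isNAt D k
  isNAt-U-suffix k x′<k = trans (isNAt-swap-suffix k x′<k) (inD (λ P → isNAt P k))

  isEAt-U-prefix : ∀ k → k < x → isEAt U k ≡ isEAt D k
  isEAt-U-prefix k k<x = trans (isEAt-swap-prefix k k<x) (inD (λ P → isEAt P k))

  isEAt-U-inside : ∀ k → x ≤ k → k < x′ → isEAt U k ≡ isEAt D (suc k)
  isEAt-U-inside k x≤k k<x′ = trans (isEAt-swap-inside k x≤k k<x′) (inD (λ P → isEAt P (suc k)))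

  isEAt-U-suffix : ∀ k → x′ < k → isEAt U k ≡ isEAt D k
  isEAt-U-suffix k x′<k = trans (isEAt-swap-suffix k x′<k) (inD (λ P → isEAt P k))

  isEAt-U-x′ : isEAt U x′ ≡ true
  isEAt-U-x′ = isEAt-swap-moved

  hdist-U-prefix : ∀ k → k ≤ x → hdist U k ≡ hdist D k
  hdist-U-prefix k k≤x = cong level (point-U-prefix k k≤x)

  hdist-U-suffix : ∀ k → x′ < k → hdist U k ≡ hdist D k
  hdist-U-suffix k x′<k = cong level (point-U-suffix k x′<k)

  hdist-U-inside : ∀ k → x ≤ k → k ≤ x′ → hdist U k ≡ suc (hdist D (suc k))
  hdist-U-inside k x≤k k≤x′ =
    trans (m∸n≡1+[m∸1+n] east-below-diagonal) (cong suc (cong level (sym moved)))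
    where
    moved : point D (suc k) ≡ map₁ suc (point U k)
    moved = point-U-inside k x≤k k≤x′
    east-below-diagonal : suc (nE k U) ≤ nN k U
    east-below-diagonal = subst (λ (x , y) → x ≤ y) moved (above (suc k))

  above-U : Above U
  above-U k with k ≤? x | k ≤? x′
  ... | yes k≤x | _       = subst (λ (x , y) → x ≤ y) (sym (point-U-prefix k k≤x)) (above k)
  ... | no  k≰x | yes k≤x′ =
    ≤-trans (n≤1+n _) (subst (λ (x , y) → x ≤ y) (point-U-inside k (≰⇒≥ k≰x) k≤x′) (above (suc k)))
  ... | no  _   | no  k≰x′ = subst (λ (x , y) → x ≤ y) (sym (point-U-suffix k (≰⇒> k≰x′))) (above k)

  level-in-D : ∀ k r → hdist U k ≡ hdist D k → hdist U r ≡ hdist D r →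
    hdist U k ≡ hdist U r → hdist D k ≡ hdist D r
  level-in-D _ _ at-k at-r eq = trans (sym at-k) (trans eq at-r)

  G : ℕ
  G = hdist D rᵢ

  east-x : isEAt D x ≡ true
  east-x = subst (λ k → isEAt D k ≡ true) (sym x≡rᵢ∸1) (proj₁ (proj₂ defined))

  hdist-x : hdist D x ≡ suc G
  hdist-x = trans (hdist-suc-E above x east-x) (cong (λ k → suc (hdist D k)) (sym rᵢ≡1+x))

  G≤hdist : ∀ k → rᵢ ≤ k → k ≤ hᵢ → G ≤ hdist D k
  G≤hdist k rᵢ≤k k≤hᵢ with m≤n⇒m<n∨m≡n rᵢ≤k
  ... | inj₁ rᵢ<k = Hit-above above north-rᵢ hit-rᵢ k rᵢ<k k≤hᵢ
  ... | inj₂ refl = ≤-refl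

  1+G≤hdist-U-inside : ∀ k → x ≤ k → k ≤ x′ → suc G ≤ hdist U k
  1+G≤hdist-U-inside k x≤k k≤x′ = subst (suc G ≤_) (sym (hdist-U-inside k x≤k k≤x′))
    (s≤s (G≤hdist (suc k) (rᵢ≤suc x≤k) (suc≤hᵢ k≤x′)))

  inside-level-not-east : ∀ k → x ≤ k → k < x′ → hdist U k ≡ suc G → isEAt U k ≡ false
  inside-level-not-east k x≤k k<x′ level with m≤n⇒m<n∨m≡n (rᵢ≤suc x≤k)
  ... | inj₂ rᵢ≡1+k = trans (isEAt-U-inside k x≤k k<x′)
          (subst (λ r → isEAt D r ≡ false) rᵢ≡1+k (isNAt⇒¬isEAt D rᵢ north-rᵢ))
  ... | inj₁ rᵢ<1+k = trans (isEAt-U-inside k x≤k k<x′) (Hit.no-hit-before hit-rᵢ (suc k) rᵢ<1+k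
          (suc≤hᵢ k<x′) (suc-injective (trans (sym (hdist-U-inside k x≤k (<⇒≤ k<x′))) level)))

  half-gap : ℕ
  half-gap = proj₁ (even-gap above (<⇒≤ rᵢ<hᵢ) hᵢ≤length (sym (Hit.level-v hit-rᵢ)))

  hᵢ≡rᵢ+2m : hᵢ ≡ rᵢ + 2 * half-gap
  hᵢ≡rᵢ+2m = proj₂ (even-gap above (<⇒≤ rᵢ<hᵢ) hᵢ≤length (sym (Hit.level-v hit-rᵢ)))

  x′≡x+2m : x′ ≡ x + 2 * half-gap
  x′≡x+2m = suc-injective (trans (sym hᵢ≡1+x′) (trans hᵢ≡rᵢ+2m (cong (_+ 2 * half-gap) rᵢ≡1+x)))

  ell-rᵢ-hᵢ : ell rᵢ hᵢ ≡ half-gap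
  ell-rᵢ-hᵢ = trans (cong (ell rᵢ) hᵢ≡rᵢ+2m)
    (trans (ell-+-double rᵢ rᵢ half-gap ≤-refl) (cong (λ n → n / 2 + half-gap) (n∸n≡0 rᵢ)))

  hᵢ≤length-U : hᵢ ≤ length U
  hᵢ≤length-U = subst (hᵢ ≤_) (sym length-U) hᵢ≤length

  prefix-no-touch-U : ∀ {r v} → r < x → hdist D r ≤ G →
    (∀ k → r < k → k < v → k ≤ x → hdist D k ≢ hdist D r) →
    (∀ k → r < k → k < v → x′ < k → hdist D k ≢ hdist D r) →
    ∀ k → r < k → k < v → hdist U k ≢ hdist U r
  prefix-no-touch-U {r} r<x r≤G early late k r<k k<v with k ≤? x | k ≤? x′
  ... | yes k≤x | _        = λ eq → early k r<k k<v k≤x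
                               (level-in-D k r (hdist-U-prefix k k≤x) (hdist-U-prefix r (<⇒≤ r<x)) eq)
  ... | no  k≰x | yes k≤x′ = λ eq → <⇒≱ (s≤s r≤G) (≤-trans (1+G≤hdist-U-inside k (≰⇒≥ k≰x) k≤x′)
                               (≤-reflexive (trans eq (hdist-U-prefix r (<⇒≤ r<x)))))
  ... | no  _   | no  k≰x′ = λ eq → late k r<k k<v (≰⇒> k≰x′)
                               (level-in-D k r (hdist-U-suffix k (≰⇒> k≰x′)) (hdist-U-prefix r (<⇒≤ r<x)) eq)

  touch-U-prefix-early : ∀ {r v} → v ≤ x → Touch D r v → Touch U r v
  touch-U-prefix-early v≤x = Touch-transport length-U (λ k _ k≤v → hdist-U-prefix k (≤-trans k≤v v≤x))

  touch-U-suffix : ∀ {r v} → x′ < r → Touch D r v → Touch U r v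
  touch-U-suffix x′<r = Touch-transport length-U (λ k r≤k _ → hdist-U-suffix k (<-≤-trans x′<r r≤k))

  touch-U-prefix-rᵢ : ∀ {r} → r < x → Touch D r rᵢ → Touch U r hᵢ
  touch-U-prefix-rᵢ {r} r<x t = record
    { r<v = <-trans r<x (<-trans x<rᵢ rᵢ<hᵢ)
    ; v≤length = hᵢ≤length-U
    ; level-v = trans (hdist-U-suffix hᵢ x′<hᵢ) (trans (Hit.level-v hit-rᵢ)
                  (trans level-v (sym (hdist-U-prefix r (<⇒≤ r<x)))))
    ; no-touch-before = prefix-no-touch-U r<x (≤-reflexive (sym level-v))
        (λ k r<k _ k≤x → no-touch-before k r<k (≤-<-trans k≤x x<rᵢ))
        (λ k _ k<hᵢ x′<k → contradiction (≤x′ k<hᵢ) (<⇒≱ x′<k))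
    }
    where open Touch t

  touch-U-prefix-late : ∀ {r v} → isNAt D r ≡ true → r < x → rᵢ < v → Touch D r v → Touch U r v
  touch-U-prefix-late {r} {v} north r<x rᵢ<v t = record
    { r<v = r<v
    ; v≤length = subst (v ≤_) (sym length-U) v≤length
    ; level-v = trans (hdist-U-suffix v x′<v) (trans level-v (sym (hdist-U-prefix r (<⇒≤ r<x))))
    ; no-touch-before = prefix-no-touch-U r<x (<⇒≤ r<G) (λ k r<k k<v _ → no-touch-before k r<k k<v)
                                                      (λ k r<k k<v _ → no-touch-before k r<k k<v)
    }
    where
    open Touch t
    r<G : hdist D r < G
    r<G = Touch-above above north t rᵢ (<-trans r<x x<rᵢ) rᵢ<v
    -- the segment from rᵢ to hᵢ never drops below G
    x′<v : x′ < v
    x′<v with x′ <? v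
    ... | yes x′<v = x′<v
    ... | no  x′≮v = contradiction (G≤hdist v (<⇒≤ rᵢ<v) (≤-trans (≮⇒≥ x′≮v) (<⇒≤ x′<hᵢ)))
                                   (<⇒≱ (subst (_< G) (sym level-v) r<G))

  touch-U-inside : ∀ {r v} → isNAt D (suc r) ≡ true → x ≤ r → r < x′ → Touch D (suc r) (suc v) → Touch U r v
  touch-U-inside {r} {v} north x≤r r<x′ t =
    Touch-shift length-U (λ k r≤k k≤v → hdist-U-inside k (≤-trans x≤r r≤k) (≤-trans k≤v v≤x′)) t
    where
    open Touch t
    G≤r : G ≤ hdist D (suc r)
    G≤r = G≤hdist (suc r) (rᵢ≤suc x≤r) (suc≤hᵢ (<⇒≤ r<x′))
    v≤x′ : v ≤ x′
    v≤x′ with v ≤? x′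
    ... | yes v≤x′ = v≤x′
    ... | no  v≰x′ = contradiction (Touch-above above north t hᵢ (suc≤hᵢ r<x′)
                                       (s≤s (hᵢ≤ (≰⇒> v≰x′))))
                                   (≤⇒≯ (subst (_≤ hdist D (suc r)) (sym (Hit.level-v hit-rᵢ)) G≤r))

  hit-U-prefix-early : ∀ {r v} → v < x → Hit D r v → Hit U r v
  hit-U-prefix-early v<x = Hit-transport length-U
    (λ k _ k≤v → hdist-U-prefix k (≤-trans k≤v (<⇒≤ v<x)))
    (λ k _ k≤v _ → isEAt-U-prefix k (≤-<-trans k≤v v<x))

  hit-U-suffix : ∀ {r v} → x′ < r → Hit D r v → Hit U r v
  hit-U-suffix x′<r = Hit-transport length-U
    (λ k r≤k _ → hdist-U-suffix k (<-≤-trans x′<r r≤k))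
    (λ k r<k _ _ → isEAt-U-suffix k (<-trans x′<r r<k))

  hit-U-prefix-x : ∀ {r} → r < x → Hit D r x → Hit U r x′
  hit-U-prefix-x {r} r<x t = record
    { r<v = <-≤-trans r<x x≤x′
    ; v≤length = <⇒≤ (<-≤-trans x′<hᵢ hᵢ≤length-U)
    ; level-v = trans (hdist-U-inside x′ x≤x′ ≤-refl)
                  (trans (cong (λ k → suc (hdist D k)) (sym hᵢ≡1+x′))
                  (trans (cong suc (Hit.level-v hit-rᵢ)) (sym level-r)))
    ; final = inj₂ isEAt-U-x′
    ; no-hit-before = no-hit-before′
    }
    where
    open Hit t
    level-r : hdist U r ≡ suc G
    level-r = trans (hdist-U-prefix r (<⇒≤ r<x)) (trans (sym level-v) hdist-x)
    no-hit-before′ : ∀ k → r < k → k < x′ → hdist U k ≡ hdist U r → isEAt U k ≡ false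
    no-hit-before′ k r<k k<x′ eq with k <? x
    ... | yes k<x = trans (isEAt-U-prefix k k<x) (no-hit-before k r<k k<x
                      (level-in-D k r (hdist-U-prefix k (<⇒≤ k<x)) (hdist-U-prefix r (<⇒≤ r<x)) eq))
    ... | no  k≮x = inside-level-not-east k (≮⇒≥ k≮x) k<x′ (trans eq level-r)

  hit-U-prefix-late : ∀ {r v} → isNAt D r ≡ true → r < x → x < v → Hit D r v → Hit U r v
  hit-U-prefix-late {r} {v} north r<x x<v t = record
    { r<v = r<v
    ; v≤length = subst (v ≤_) (sym length-U) v≤length
    ; level-v = trans (hdist-U-suffix v x′<v) (trans level-v (sym (hdist-U-prefix r (<⇒≤ r<x))))
    ; final = final′
    ; no-hit-before = no-hit-before′
    }
    where
    open Hit t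
    -- otherwise the east step at x would be an earlier hit point
    r≤G : hdist D r ≤ G
    r≤G = s≤s⁻¹ (≤∧≢⇒< (subst (hdist D r ≤_) hdist-x (Hit-above above north t x r<x (<⇒≤ x<v)))
            (λ eq → true≢false (trans (sym east-x) (no-hit-before x r<x x<v (trans hdist-x (sym eq))))))
    x′<v : x′ < v
    x′<v with x′ <? v
    ... | yes x′<v = x′<v
    ... | no  x′≮v = contradiction (trans (sym east-v) (Hit.no-hit-before hit-rᵢ v rᵢ<v v<hᵢ level-G)) true≢false
      where
      v<hᵢ : v < hᵢ
      v<hᵢ = ≤-<-trans (≮⇒≥ x′≮v) x′<hᵢ
      east-v : isEAt D v ≡ true
      east-v with final
      ... | inj₁ atEnd = contradiction (<-≤-trans v<hᵢ hᵢ≤length) (<-irrefl atEnd)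
      ... | inj₂ east  = east
      rᵢ<v : rᵢ < v
      rᵢ<v with m≤n⇒m<n∨m≡n (subst (_≤ v) (sym rᵢ≡1+x) x<v)
      ... | inj₁ rᵢ<v = rᵢ<v
      ... | inj₂ refl = contradiction (trans (sym east-v) (isNAt⇒¬isEAt D rᵢ north-rᵢ)) true≢false
      level-G : hdist D v ≡ G
      level-G = ≤-antisym (subst (_≤ G) (sym level-v) r≤G) (G≤hdist v (<⇒≤ rᵢ<v) (<⇒≤ v<hᵢ))
    final′ : v ≡ length U ⊎ isEAt U v ≡ true
    final′ with final
    ... | inj₁ atEnd = inj₁ (trans atEnd (sym length-U))
    ... | inj₂ east  = inj₂ (trans (isEAt-U-suffix v x′<v) east)
    no-hit-before′ : ∀ k → r < k → k < v → hdist U k ≡ hdist U r → isEAt U k ≡ false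
    no-hit-before′ k r<k k<v eq with k <? x | k ≤? x′
    ... | yes k<x | _        = trans (isEAt-U-prefix k k<x) (no-hit-before k r<k k<v
                                 (level-in-D k r (hdist-U-prefix k (<⇒≤ k<x)) (hdist-U-prefix r (<⇒≤ r<x)) eq))
    ... | no  k≮x | yes k≤x′ = contradiction (≤-trans (1+G≤hdist-U-inside k (≮⇒≥ k≮x) k≤x′)
                                 (≤-reflexive (trans eq (hdist-U-prefix r (<⇒≤ r<x))))) (<⇒≱ (s≤s r≤G))
    ... | no  _   | no  k≰x′ = trans (isEAt-U-suffix k (≰⇒> k≰x′)) (no-hit-before k r<k k<v
                                 (level-in-D k r (hdist-U-suffix k (≰⇒> k≰x′)) (hdist-U-prefix r (<⇒≤ r<x)) eq))

  hit-U-inside : ∀ {r v} → isNAt D (suc r) ≡ true → x ≤ r → r < x′ → Hit D (suc r) (suc v) → Hit U r v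
  hit-U-inside {r} {v} north x≤r r<x′ t =
    Hit-shift length-U (λ k r≤k k≤v → hdist-U-inside k (≤-trans x≤r r≤k) (≤-trans k≤v v≤x′))
      (λ k r<k k<v → isEAt-U-inside k (≤-trans x≤r (<⇒≤ r<k)) (<-≤-trans k<v v≤x′)) final′ t
    where
    open Hit t
    1+r<hᵢ : suc r < hᵢ
    1+r<hᵢ = suc≤hᵢ r<x′
    v≤x′ : v ≤ x′
    v≤x′ with v ≤? x′
    ... | yes v≤x′ = v≤x′
    ... | no  v≰x′ = contradiction (Hit.final hit-rᵢ) λ
        { (inj₁ atEnd) → <⇒≱ (<-≤-trans hᵢ<1+v v≤length) (≤-reflexive (sym atEnd))
        ; (inj₂ east)  → true≢false (trans (sym east) (no-hit-before hᵢ 1+r<hᵢ hᵢ<1+v level-hᵢ))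
        }
      where
      hᵢ<1+v : hᵢ < suc v
      hᵢ<1+v = s≤s (hᵢ≤ (≰⇒> v≰x′))
      G≤r : G ≤ hdist D (suc r)
      G≤r = G≤hdist (suc r) (rᵢ≤suc x≤r) (<⇒≤ 1+r<hᵢ)
      level-hᵢ : hdist D hᵢ ≡ hdist D (suc r)
      level-hᵢ = ≤-antisym (subst (_≤ hdist D (suc r)) (sym (Hit.level-v hit-rᵢ)) G≤r)
                           (Hit-above above north t hᵢ 1+r<hᵢ (<⇒≤ hᵢ<1+v))
    final′ : v ≡ length U ⊎ isEAt U v ≡ true
    final′ with v <? x′ | final
    ... | yes v<x′ | inj₁ atEnd = contradiction (<-≤-trans (suc≤hᵢ v<x′) hᵢ≤length)
                                                (<-irrefl atEnd)
    ... | yes v<x′ | inj₂ east  = inj₂ (trans (isEAt-U-inside v (≤-trans x≤r (<⇒≤ (s≤s⁻¹ r<v))) v<x′) east)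
    ... | no  v≮x′ | _          = inj₂ (subst (λ k → isEAt U k ≡ true) (≤-antisym (≮⇒≥ v≮x′) v≤x′) isEAt-U-x′)

  ell-through-rᵢ : ∀ r → r ≤ rᵢ → ell r hᵢ ≡ ell r rᵢ + ell rᵢ hᵢ
  ell-through-rᵢ r r≤rᵢ = begin
    ell r hᵢ                        ≡⟨ cong (ell r) hᵢ≡rᵢ+2m ⟩
    ell r (rᵢ + 2 * half-gap)       ≡⟨ ell-+-double r rᵢ half-gap r≤rᵢ ⟩
    ell r rᵢ + half-gap             ≡⟨ cong (ell r rᵢ +_) ell-rᵢ-hᵢ ⟨
    ell r rᵢ + ell rᵢ hᵢ            ∎
    where open ≡-Reasoning

  ell-through-x : ∀ r → r ≤ x → ell r x′ ≡ ell r x + ell rᵢ hᵢ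
  ell-through-x r r≤x = begin
    ell r x′                        ≡⟨ cong (ell r) x′≡x+2m ⟩
    ell r (x + 2 * half-gap)        ≡⟨ ell-+-double r x half-gap r≤x ⟩
    ell r x + half-gap              ≡⟨ cong (ell r x +_) ell-rᵢ-hᵢ ⟨
    ell r x + ell rᵢ hᵢ             ∎
    where open ≡-Reasoning

  dt-U : ∀ {r v j} → rPos U j ≡ r → Touch U r v → dt U j ≡ ell r v
  dt-U {r} r≡ t = cong₂ ell r≡ (trans (cong (touchFrom U) r≡) (touchFrom-unique above-U t))

  dh-U : ∀ {r v j} → rPos U j ≡ r → Hit U r v → dh U j ≡ ell r v
  dh-U {r} r≡ t = cong₂ ell r≡ (trans (cong (hitFrom U) r≡) (hitFrom-unique above-U t))

  data Region : ℕ → Set where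
    prefix : ∀ {r} → r < x → Region r
    inside : ∀ {r} → x ≤ r → r < x′ → Region (suc r)
    suffix : ∀ {r} → x′ < r → Region r

  region : ∀ r → isNAt D r ≡ true → Region r
  region r north with r <? x
  ... | yes r<x = prefix r<x
  ... | no  r≮x with m≤n⇒m<n∨m≡n (≮⇒≥ r≮x)
  ...   | inj₂ refl = contradiction (trans (sym east-x) (isNAt⇒¬isEAt D x north)) true≢false
  ...   | inj₁ x<r  = after-x r x<r
    where
    after-x : ∀ r → x < r → Region r
    after-x (suc r) (s≤s x≤r) with r <? x′
    ... | yes r<x′ = inside x≤r r<x′
    ... | no  r≮x′ = suffix (s≤s (≮⇒≥ r≮x′))

  private
    rPos-from : ∀ {P r j} → isNAt P r ≡ true → nN r P ≡ j → rPos P j ≡ r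
    rPos-from {P} {r} north refl = nthN-unique P r north

  rPos-U-prefix : ∀ {r} → r < x → isNAt D r ≡ true → rPos U (nN r D) ≡ r
  rPos-U-prefix r<x north =
    rPos-from (trans (isNAt-U-prefix _ r<x) north) (cong proj₂ (point-U-prefix _ (<⇒≤ r<x)))

  rPos-U-inside : ∀ {r} → x ≤ r → r < x′ → isNAt D (suc r) ≡ true → rPos U (nN (suc r) D) ≡ r
  rPos-U-inside x≤r r<x′ north =
    rPos-from (trans (isNAt-U-inside _ x≤r r<x′) north) (cong proj₂ (sym (point-U-inside _ x≤r (<⇒≤ r<x′))))

  rPos-U-suffix : ∀ {r} → x′ < r → isNAt D r ≡ true → rPos U (nN r D) ≡ r
  rPos-U-suffix x′<r north =
    rPos-from (trans (isNAt-U-suffix _ x′<r) north) (cong proj₂ (point-U-suffix _ x′<r))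

  touch-claim : ∀ {r v j} → Region r → isNAt D r ≡ true → nN r D ≡ j → Touch D r v →
    ShiftClaim D v rᵢ (dt U j) (ell r v) (ell rᵢ hᵢ)
  touch-claim {r} {v} (prefix r<x) north refl t with <-cmp v rᵢ
  ... | tri< v<rᵢ _ _ = ShiftClaim-unchanged _ v≤length rᵢ≤length (<⇒≢ v<rᵢ)
        (dt-U (rPos-U-prefix r<x north) (touch-U-prefix-early (s≤s⁻¹ (subst (v <_) rᵢ≡1+x v<rᵢ)) t))
    where open Touch t
  ... | tri≈ _ refl _ = ShiftClaim-extended {D} {rᵢ} refl
        (trans (dt-U (rPos-U-prefix r<x north) (touch-U-prefix-rᵢ r<x t))
               (ell-through-rᵢ r (<⇒≤ (Touch.r<v t))))
  ... | tri> _ _ rᵢ<v = ShiftClaim-unchanged _ v≤length rᵢ≤length (≢-sym (<⇒≢ rᵢ<v))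
        (dt-U (rPos-U-prefix r<x north) (touch-U-prefix-late north r<x rᵢ<v t))
    where open Touch t
  touch-claim {v = zero} (inside _ _) _ _ t = contradiction (Touch.r<v t) λ ()
  touch-claim {suc r} {suc v} (inside x≤r r<x′) north refl t =
    ShiftClaim-unchanged _ v≤length rᵢ≤length (λ eq → <⇒≱ r<v (subst (_≤ suc r) (sym eq) rᵢ≤1+r))
      (dt-U (rPos-U-inside x≤r r<x′ north) (touch-U-inside north x≤r r<x′ t))
    where
    open Touch t
    rᵢ≤1+r : rᵢ ≤ suc r
    rᵢ≤1+r = rᵢ≤suc x≤r
  touch-claim {r} {v} (suffix x′<r) north refl t =
    ShiftClaim-unchanged _ v≤length rᵢ≤length
      (λ eq → <⇒≱ (<-trans x′<r r<v) (subst (_≤ x′) (sym eq) rᵢ≤x′))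
      (dt-U (rPos-U-suffix x′<r north) (touch-U-suffix x′<r t))
    where open Touch t

  hit-claim : ∀ {r v j} → Region r → isNAt D r ≡ true → nN r D ≡ j → Hit D r v →
    ShiftClaim D v (rᵢ ∸ 1) (dh U j) (ell r v) (ell rᵢ hᵢ)
  hit-claim {r} {v} (prefix r<x) north refl t with <-cmp v x
  ... | tri< v<x _ _ = ShiftClaim-unchanged _ v≤length rᵢ∸1≤length (<⇒≢ (subst (v <_) x≡rᵢ∸1 v<x))
        (dh-U (rPos-U-prefix r<x north) (hit-U-prefix-early v<x t))
    where open Hit t
  ... | tri≈ _ refl _ = ShiftClaim-extended {D} {x} x≡rᵢ∸1
        (trans (dh-U (rPos-U-prefix r<x north) (hit-U-prefix-x r<x t)) (ell-through-x r (<⇒≤ r<x)))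
  ... | tri> _ _ x<v = ShiftClaim-unchanged _ v≤length rᵢ∸1≤length (≢-sym (<⇒≢ (subst (_< v) x≡rᵢ∸1 x<v)))
        (dh-U (rPos-U-prefix r<x north) (hit-U-prefix-late north r<x x<v t))
    where open Hit t
  hit-claim {v = zero} (inside _ _) _ _ t = contradiction (Hit.r<v t) λ ()
  hit-claim {suc r} {suc v} (inside x≤r r<x′) north refl t =
    ShiftClaim-unchanged _ v≤length rᵢ∸1≤length
      (λ eq → <⇒≱ r<v (subst (_≤ suc r) (trans x≡rᵢ∸1 (sym eq)) (≤-trans x≤r (n≤1+n r))))
      (dh-U (rPos-U-inside x≤r r<x′ north) (hit-U-inside north x≤r r<x′ t))
    where open Hit t
  hit-claim {r} {v} (suffix x′<r) north refl t =
    ShiftClaim-unchanged _ v≤length rᵢ∸1≤length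
      (λ eq → <⇒≱ (<-trans x′<r r<v) (subst (_≤ x′) (trans x≡rᵢ∸1 (sym eq)) x≤x′))
      (dh-U (rPos-U-suffix x′<r north) (hit-U-suffix x′<r t))
    where open Hit t

mainTheorem14 : (m n : ℕ) → 1 ≤ m → 1 ≤ n → (D : Path) → IsDyck (m * n) D →
    (i : Fin (m * n)) → GreedyDefined D (toℕ i) → (j : Fin (m * n)) →
    ((point D (tPos D (toℕ j)) ≢ point D (rPos D (toℕ i)) →
        dt (greedyUp D (toℕ i)) (toℕ j) ≡ dt D (toℕ j))
     × (point D (tPos D (toℕ j)) ≡ point D (rPos D (toℕ i)) →
        dt (greedyUp D (toℕ i)) (toℕ j) ≡ dt D (toℕ j) + ell (rPos D (toℕ i)) (hPos D (toℕ i))))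
    × ((point D (hPos D (toℕ j)) ≢ point D (rPos D (toℕ i) ∸ 1) →
        dh (greedyUp D (toℕ i)) (toℕ j) ≡ dh D (toℕ j))
     × (point D (hPos D (toℕ j)) ≡ point D (rPos D (toℕ i) ∸ 1) →
        dh (greedyUp D (toℕ i)) (toℕ j) ≡ dh D (toℕ j) + ell (rPos D (toℕ i)) (hPos D (toℕ i))))
mainTheorem14 m n _ _ D dyck i defined j =
  touch-claim rⱼ-region north-rⱼ count-rⱼ (touchFrom-touch north-rⱼ) ,
  hit-claim rⱼ-region north-rⱼ count-rⱼ (hitFrom-hit north-rⱼ)
  where
  open DyckPath dyck
  open Greedy dyck (toℕ i) defined
  j<northCount : toℕ j < nN (length D) D
  j<northCount = subst (toℕ j <_) (sym (IsDyck.northCount dyck)) (toℕ<n j)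
  north-rⱼ : isNAt D (rPos D (toℕ j)) ≡ true
  north-rⱼ = nthN-isNAt D (toℕ j) j<northCount
  count-rⱼ : nN (rPos D (toℕ j)) D ≡ toℕ j
  count-rⱼ = nN-nthN D (toℕ j) j<northCount
  rⱼ-region : Region (rPos D (toℕ j))
  rⱼ-region = region (rPos D (toℕ j)) north-rⱼ
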